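{- Let $\mathbb{C}$ be an adhesive category. Suppose given a double square diagram $L\xleftarrow{a}K\xrightarrow{b}R$, $X\xleftarrow{c}Y\xrightarrow{d}Z$, $m\colon L\to X$, $j\colon K\to Y$, $n\colon R\to Z$ (with $m\circ a=c\circ j$, $n\circ b=d\circ j$) in which $L\xrightarrow{m}X\xleftarrow{c}Y$ is a pushout of $L\xleftarrow{a}K\xrightarrow{j}Y$ and $Y\xrightarrow{d}Z\xleftarrow{n}R$ is a pushout of $Y\xleftarrow{j}K\xrightarrow{b}R$; suppose further that either $a$ and $m$ are monomorphisms, or $a$ and $b$ are monomorphisms. Suppose also given objects $L',K',R',X'$ and morphisms $a'\colon K'\to L'$, $b'\colon K'\to R'$, $m'\colon L'\to X'$, $\psi_L\colon L'\to L$, $\psi_K\colon K'\to K$, $\psi_R\colon R'\to R$, $\psi_X\colon X'\to X$ such that the squares $\psi_L\circ a'=a\circ\psi_K$, $\psi_R\circ b'=b\circ\psi_K$ and $\psi_X\circ m'=m\circ\psi_L$ commute and are pullbacks. Then there exist objects $Y',Z'$ and morphisms $c'\colon Y'\to X'$, $d'\colon Y'\to Z'$, $j'\colon K'\to Y'$, $n'\colon R'\to Z'$, $\psi_Y\colon Y'\to Y$, $\psi_Z\colon Z'\to Z$ such that $L'\xrightarrow{m'}X'\xleftarrow{c'}Y'$ is a pushout of $L'\xleftarrow{a'}K'\xrightarrow{j'}Y'$, $Y'\xrightarrow{d'}Z'\xleftarrow{n'}R'$ is a pushout of $Y'\xleftarrow{j'}K'\xrightarrow{b'}R'$, and the squares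 $\psi_Y\circ j'=j\circ\psi_K$, $\psi_X\circ c'=c\circ\psi_Y$, $\psi_Z\circ d'=d\circ\psi_Y$, $\psi_Z\circ n'=n\circ\psi_R$ commute and are all pullbacks.
   Context: A category is adhesive if (1) it has pullbacks; (2) it has pushouts along monomorphisms (a pushout of $B\xleftarrow{f}A\xrightarrow{m}C$ exists whenever $m$ is mono); and (3) pushouts along monomorphisms are Van Kampen squares: if $B\xrightarrow{n}D\xleftarrow{g}C$ is a pushout of $B\xleftarrow{f}A\xrightarrow{m}C$ with $m$ mono, then for every commutative cube over this square whose two back faces (over $f$ and over $m$) are pullbacks, the top face is a pushout if and only if the two front faces (over $n$ and over $g$) are pullbacks. -}

module Defs where

open import Level using (Level; _⊔_; suc)
open import Relation.Binary.Structures using (IsEquivalence)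
open import Data.Product using (Σ; _×_; _,_; ∃-syntax)
open import Data.Sum using (_⊎_)

record Category (o ℓ e : Level) : Set (Level.suc (o ⊔ ℓ ⊔ e)) where
  infix  4 _≈_
  infixr 9 _∘_
  field
    Obj : Set o
    _⇒_ : Obj → Obj → Set ℓ
    _≈_ : ∀ {A B} → A ⇒ B → A ⇒ B → Set e
    id  : ∀ {A} → A ⇒ A
    _∘_ : ∀ {A B C} → B ⇒ C → A ⇒ B → A ⇒ C
    equiv     : ∀ {A B} → IsEquivalence (_≈_ {A} {B})
    ∘-resp-≈  : ∀ {A B C} {f h : B ⇒ C} {g i : A ⇒ B} → f ≈ h → g ≈ i → f ∘ g ≈ h ∘ i
    assoc     : ∀ {A B C D} {f : A ⇒ B} {g : B ⇒ C} {h : C ⇒ D} → (h ∘ g) ∘ f ≈ h ∘ (g ∘ f)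
    identityˡ : ∀ {A B} {f : A ⇒ B} → id ∘ f ≈ f
    identityʳ : ∀ {A B} {f : A ⇒ B} → f ∘ id ≈ f

module _ {o ℓ e} (𝒞 : Category o ℓ e) where
  open Category 𝒞

  Mono : ∀ {A B} → A ⇒ B → Set (o ⊔ ℓ ⊔ e)
  Mono {A} f = ∀ {W} (g h : W ⇒ A) → f ∘ g ≈ f ∘ h → g ≈ h

  IsPullback : ∀ {P A B C} (p₁ : P ⇒ A) (p₂ : P ⇒ B) (f : A ⇒ C) (g : B ⇒ C)
             → Set (o ⊔ ℓ ⊔ e)
  IsPullback {P} {A} {B} p₁ p₂ f g =
    (f ∘ p₁ ≈ g ∘ p₂) ×
    (∀ {W} (h₁ : W ⇒ A) (h₂ : W ⇒ B) → f ∘ h₁ ≈ g ∘ h₂ →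
       Σ (W ⇒ P) λ u → (p₁ ∘ u ≈ h₁) × (p₂ ∘ u ≈ h₂) ×
         (∀ (v : W ⇒ P) → p₁ ∘ v ≈ h₁ → p₂ ∘ v ≈ h₂ → v ≈ u))

  IsPushout : ∀ {A B C Q} (f : A ⇒ B) (g : A ⇒ C) (i₁ : B ⇒ Q) (i₂ : C ⇒ Q)
            → Set (o ⊔ ℓ ⊔ e)
  IsPushout {A} {B} {C} {Q} f g i₁ i₂ =
    (i₁ ∘ f ≈ i₂ ∘ g) ×
    (∀ {W} (h₁ : B ⇒ W) (h₂ : C ⇒ W) → h₁ ∘ f ≈ h₂ ∘ g →
       Σ (Q ⇒ W) λ u → (u ∘ i₁ ≈ h₁) × (u ∘ i₂ ≈ h₂) ×
         (∀ (v : Q ⇒ W) → v ∘ i₁ ≈ h₁ → v ∘ i₂ ≈ h₂ → v ≈ u))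

  HasPullbacks : Set (o ⊔ ℓ ⊔ e)
  HasPullbacks = ∀ {A B C} (f : A ⇒ C) (g : B ⇒ C) →
    Σ Obj λ P → Σ (P ⇒ A) λ p₁ → Σ (P ⇒ B) λ p₂ → IsPullback p₁ p₂ f g

  HasPushoutsAlongMonos : Set (o ⊔ ℓ ⊔ e)
  HasPushoutsAlongMonos = ∀ {A B C} (f : A ⇒ B) (m : A ⇒ C) → Mono m →
    Σ Obj λ D → Σ (B ⇒ D) λ n → Σ (C ⇒ D) λ g → IsPushout f m n g

  IsVanKampen : ∀ {A B C D} (f : A ⇒ B) (m : A ⇒ C) (n : B ⇒ D) (g : C ⇒ D)
              → Set (o ⊔ ℓ ⊔ e)
  IsVanKampen {A} {B} {C} {D} f m n g =
    ∀ {A' B' C' D' : Obj}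
      (f' : A' ⇒ B') (m' : A' ⇒ C') (n' : B' ⇒ D') (g' : C' ⇒ D')
      (α : A' ⇒ A) (β : B' ⇒ B) (γ : C' ⇒ C) (δ : D' ⇒ D) →
      n' ∘ f' ≈ g' ∘ m' →
      IsPullback f' α β f →
      IsPullback m' α γ m →
      δ ∘ n' ≈ n ∘ β →
      δ ∘ g' ≈ g ∘ γ →
      (IsPushout f' m' n' g' → IsPullback n' β δ n × IsPullback g' γ δ g) ×
      (IsPullback n' β δ n × IsPullback g' γ δ g → IsPushout f' m' n' g')

record Adhesive {o ℓ e} (𝒞 : Category o ℓ e) : Set (Level.suc (o ⊔ ℓ ⊔ e)) where
  open Category 𝒞
  field
    pullbacks : HasPullbacks 𝒞
    pushouts  : HasPushoutsAlongMonos 𝒞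
    vanKampen : ∀ {A B C D} (f : A ⇒ B) (m : A ⇒ C) (n : B ⇒ D) (g : C ⇒ D) →
                Mono 𝒞 m → IsPushout 𝒞 f m n g → IsVanKampen 𝒞 f m n g

module Submission where

-- Complete the cube over the first pushout  L ←a K →j Y  by pulling
-- ψX back along c; this gives Y', c', ψY, and j' is induced by the
-- universal property.  Pullback pasting shows that the new face over j is a
-- pullback, so every vertical face of the cube over the first pushout is a
-- pullback and the Van Kampen property (read "front faces ⇒ top") makes the
-- top face a pushout.  For the second pushout  Y ←j K →b R  one of the legs
-- j, b is mono: b by hypothesis, or j because a pushout along the mono a is
-- a pullback, so j is a pullback of the mono m.  Its pullback j' or b' is
-- then mono, so the top pushout exists, and the Van Kampen property (read
-- "top ⇒ front faces") makes its front faces pullbacks.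

open import Defs
open import Level using (Level)
open import Data.Product using (Σ; _×_; _,_; proj₁; proj₂)
open import Data.Sum using (_⊎_; inj₁; inj₂)
open import Relation.Binary.Bundles using (Setoid)
open import Relation.Binary.Structures using (IsEquivalence)
import Relation.Binary.Reasoning.Setoid as SetoidReasoning

module SquareFacts {o ℓ e} (𝒞 : Category o ℓ e) where
  open Category 𝒞
  module HomEquivalence {A B} = IsEquivalence (equiv {A} {B})

  ≈-refl : ∀ {A B} {f : A ⇒ B} → f ≈ f
  ≈-refl = HomEquivalence.refl

  ≈-sym : ∀ {A B} {f g : A ⇒ B} → f ≈ g → g ≈ f
  ≈-sym = HomEquivalence.sym

  ≈-trans : ∀ {A B} {f g h : A ⇒ B} → f ≈ g → g ≈ h → f ≈ h
  ≈-trans = HomEquivalence.trans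

  hom-setoid : ∀ {A B} → Setoid ℓ e
  hom-setoid {A} {B} = record { Carrier = A ⇒ B ; _≈_ = _≈_ ; isEquivalence = equiv }

  infixr 5 _⟩∘⟨_
  _⟩∘⟨_ : ∀ {A B C} {f h : B ⇒ C} {g i : A ⇒ B} → f ≈ h → g ≈ i → f ∘ g ≈ h ∘ i
  _⟩∘⟨_ = ∘-resp-≈

  assoc⁻¹ : ∀ {A B C D} {f : A ⇒ B} {g : B ⇒ C} {h : C ⇒ D} → h ∘ (g ∘ f) ≈ (h ∘ g) ∘ f
  assoc⁻¹ = ≈-sym assoc

  paste-squares : ∀ {A B A' B' C C'} {f : A ⇒ B} {f' : A' ⇒ B'} {g : B ⇒ C} {g' : B' ⇒ C'}
    {α : A' ⇒ A} {β : B' ⇒ B} {γ : C' ⇒ C} →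
    β ∘ f' ≈ f ∘ α → γ ∘ g' ≈ g ∘ β → γ ∘ (g' ∘ f') ≈ (g ∘ f) ∘ α
  paste-squares lower upper =
    ≈-trans assoc⁻¹ (≈-trans (upper ⟩∘⟨ ≈-refl)
      (≈-trans assoc (≈-trans (≈-refl ⟩∘⟨ lower) assoc⁻¹)))

  pullback-resp-≈ : ∀ {P A B C} {p₁ p₁' : P ⇒ A} {p₂ : P ⇒ B} {f : A ⇒ C} {g g' : B ⇒ C} →
    IsPullback 𝒞 p₁ p₂ f g → p₁ ≈ p₁' → g ≈ g' → IsPullback 𝒞 p₁' p₂ f g'
  pullback-resp-≈ (commutes , universal) p₁≈p₁' g≈g' =
    ≈-trans (≈-refl ⟩∘⟨ ≈-sym p₁≈p₁') (≈-trans commutes (g≈g' ⟩∘⟨ ≈-refl)) ,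
    λ h₁ h₂ eq →
      let (u , u₁ , u₂ , unique) = universal h₁ h₂ (≈-trans eq (≈-sym g≈g' ⟩∘⟨ ≈-refl))
      in u , ≈-trans (≈-sym p₁≈p₁' ⟩∘⟨ ≈-refl) u₁ , u₂ ,
         λ v v₁ v₂ → unique v (≈-trans (p₁≈p₁' ⟩∘⟨ ≈-refl) v₁) v₂

  pullback-paste : ∀ {P A B C D E} {p₁ : P ⇒ A} {p₂ : P ⇒ B} {f : A ⇒ C} {g : B ⇒ C}
    {q : A ⇒ D} {h : D ⇒ E} {k : C ⇒ E} →
    IsPullback 𝒞 p₁ p₂ f g → IsPullback 𝒞 q f h k →
    IsPullback 𝒞 (q ∘ p₁) p₂ h (k ∘ g)
  pullback-paste {p₁ = p₁} {g = g} (left , universalˡ) (right , universalʳ) =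
    paste-squares left right ,
    λ h₁ h₂ eq →
      let (w , w₁ , w₂ , uniqueʳ) = universalʳ h₁ (g ∘ h₂) (≈-trans eq assoc)
          (u , u₁ , u₂ , uniqueˡ) = universalˡ w h₂ w₂
      in u , ≈-trans assoc (≈-trans (≈-refl ⟩∘⟨ u₁) w₁) , u₂ ,
         λ v v₁ v₂ → uniqueˡ v
           (uniqueʳ (p₁ ∘ v) (≈-trans assoc⁻¹ v₁)
             (≈-trans assoc⁻¹ (≈-trans (left ⟩∘⟨ ≈-refl)
               (≈-trans assoc (≈-refl ⟩∘⟨ v₂)))))
           v₂

  pullback-cancel : ∀ {P A B A₂ B₂ C} {p₁ : P ⇒ A} {p₂ : P ⇒ B} {q₁ : A ⇒ A₂} {q₂ : A ⇒ B₂}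
    {h : A₂ ⇒ C} {k : B₂ ⇒ C} {g : B ⇒ B₂} →
    IsPullback 𝒞 q₁ q₂ h k → IsPullback 𝒞 (q₁ ∘ p₁) p₂ h (k ∘ g) →
    q₂ ∘ p₁ ≈ g ∘ p₂ → IsPullback 𝒞 p₁ p₂ q₂ g
  pullback-cancel {p₁ = p₁} {q₁ = q₁} {q₂} (right , universalʳ) (_ , universal) left =
    left ,
    λ h₁ h₂ eq →
      let (u , u₁ , u₂ , unique) = universal (q₁ ∘ h₁) h₂
            (≈-trans assoc⁻¹ (≈-trans (right ⟩∘⟨ ≈-refl)
              (≈-trans assoc (≈-trans (≈-refl ⟩∘⟨ eq) assoc⁻¹))))
          (_ , _ , _ , uniqueʳ) = universalʳ (q₁ ∘ h₁) (q₂ ∘ h₁)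
            (≈-trans assoc⁻¹ (≈-trans (right ⟩∘⟨ ≈-refl) assoc))
          -- both p₁ ∘ u and h₁ are the mediating map into A of the same cone
          p₁u≈h₁ = ≈-trans
            (uniqueʳ (p₁ ∘ u) (≈-trans assoc⁻¹ u₁)
              (≈-trans assoc⁻¹ (≈-trans (left ⟩∘⟨ ≈-refl)
                (≈-trans assoc (≈-trans (≈-refl ⟩∘⟨ u₂) (≈-sym eq))))))
            (≈-sym (uniqueʳ h₁ ≈-refl ≈-refl))
      in u , p₁u≈h₁ , u₂ , λ v v₁ v₂ → unique v (≈-trans assoc (≈-refl ⟩∘⟨ v₁)) v₂

  pullback-of-mono : ∀ {P A B C} {p₁ : P ⇒ A} {p₂ : P ⇒ B} {f : A ⇒ C} {g : B ⇒ C} →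
    IsPullback 𝒞 p₁ p₂ f g → Mono 𝒞 g → Mono 𝒞 p₁
  pullback-of-mono {p₁ = p₁} {p₂} (commutes , universal) g-mono x y p₁x≈p₁y =
    let p₂x≈p₂y = g-mono (p₂ ∘ x) (p₂ ∘ y)
          (≈-trans assoc⁻¹ (≈-trans (≈-sym commutes ⟩∘⟨ ≈-refl)
            (≈-trans assoc (≈-trans (≈-refl ⟩∘⟨ p₁x≈p₁y)
              (≈-trans assoc⁻¹ (≈-trans (commutes ⟩∘⟨ ≈-refl) assoc))))))
        (_ , _ , _ , unique) = universal (p₁ ∘ x) (p₂ ∘ x)
          (≈-trans assoc⁻¹ (≈-trans (commutes ⟩∘⟨ ≈-refl) assoc))
    in ≈-trans (unique x ≈-refl ≈-refl) (≈-sym (unique y (≈-sym p₁x≈p₁y) (≈-sym p₂x≈p₂y)))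

  pushout-swap : ∀ {A B C Q} {f : A ⇒ B} {g : A ⇒ C} {i₁ : B ⇒ Q} {i₂ : C ⇒ Q} →
    IsPushout 𝒞 f g i₁ i₂ → IsPushout 𝒞 g f i₂ i₁
  pushout-swap (commutes , universal) = ≈-sym commutes , λ h₁ h₂ eq →
    let (u , u₁ , u₂ , unique) = universal h₂ h₁ (≈-sym eq)
    in u , u₂ , u₁ , λ v v₁ v₂ → unique v v₂ v₁

  identity-pullback : ∀ {A B} (f : A ⇒ B) → IsPullback 𝒞 f id id f
  identity-pullback f = ≈-trans identityˡ (≈-sym identityʳ) , λ _ h₂ eq →
    h₂ , ≈-trans (≈-sym eq) identityˡ , identityˡ , λ v _ v₂ → ≈-trans (≈-sym identityˡ) v₂

  identity-pushout : ∀ {A B} (f : A ⇒ B) → IsPushout 𝒞 f id id f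
  identity-pushout f = ≈-trans identityˡ (≈-sym identityʳ) , λ h₁ _ eq →
    h₁ , identityʳ , ≈-trans eq identityʳ , λ v v₁ _ → ≈-trans (≈-sym identityʳ) v₁

  mono-kernel-pair : ∀ {A C} {m : A ⇒ C} → Mono 𝒞 m → IsPullback 𝒞 id id m m
  mono-kernel-pair m-mono = ≈-refl , λ h₁ h₂ eq →
    h₁ , identityˡ , ≈-trans identityˡ (m-mono h₁ h₂ eq) ,
    λ v v₁ _ → ≈-trans (≈-sym identityˡ) v₁

module AdhesiveFacts {o ℓ e} (𝒞 : Category o ℓ e) (adhesive : Adhesive 𝒞) where
  open Category 𝒞
  open Adhesive adhesive
  open SquareFacts 𝒞

  -- A pushout along a mono is a pullback: apply the Van Kampen property to
  -- the cube whose top is the identity pushout of f and whose back faces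
  -- are the identity pullback of f and the kernel pair of m.
  pushout-along-mono-is-pullback : ∀ {A B C D} {f : A ⇒ B} {m : A ⇒ C} {n : B ⇒ D} {g : C ⇒ D} →
    Mono 𝒞 m → IsPushout 𝒞 f m n g → IsPullback 𝒞 f m n g
  pushout-along-mono-is-pullback {f = f} {m} {n} {g} m-mono pushout =
    proj₂ (proj₁ (vanKampen f m n g m-mono pushout f id id f id id m n
                    (proj₁ (identity-pullback f)) (identity-pullback f) (mono-kernel-pair m-mono)
                    ≈-refl (proj₁ pushout))
                 (identity-pushout f))

  -- Given a pushout  n ∘ f ≈ g ∘ m  with
  -- m mono and pullback squares over m and over g, pull δ back along n: the
  -- induced cube has all vertical faces pullbacks and a pushout on top.
  restrict-pushout : ∀ {A B C D A' C' D'} {f : A ⇒ B} {m : A ⇒ C} {n : B ⇒ D} {g : C ⇒ D}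
    {m' : A' ⇒ C'} {g' : C' ⇒ D'} {α : A' ⇒ A} {γ : C' ⇒ C} {δ : D' ⇒ D} →
    Mono 𝒞 m → IsPushout 𝒞 f m n g →
    IsPullback 𝒞 m' α γ m → IsPullback 𝒞 g' γ δ g →
    Σ Obj λ B' → Σ (A' ⇒ B') λ f' → Σ (B' ⇒ D') λ n' → Σ (B' ⇒ B) λ β →
      IsPushout 𝒞 f' m' n' g' × IsPullback 𝒞 f' α β f × IsPullback 𝒞 n' β δ n
  restrict-pushout {f = f} {m} {n} {g} {m'} {g'} {α} {γ} {δ} m-mono pushout pb-m pb-g =
    let (B' , n' , β , pb-n) = pullbacks δ n
        cone : δ ∘ (g' ∘ m') ≈ n ∘ (f ∘ α)
        cone = ≈-trans (paste-squares (proj₁ pb-m) (proj₁ pb-g))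
                 (≈-trans (≈-sym (proj₁ pushout) ⟩∘⟨ ≈-refl) assoc)
        (f' , n'f'≈g'm' , βf'≈fα , _) = proj₂ pb-n (g' ∘ m') (f ∘ α) cone
        -- the rectangle over n ∘ f ≈ g ∘ m is the paste of the pullbacks over m and g
        rectangle : IsPullback 𝒞 (n' ∘ f') α δ (n ∘ f)
        rectangle = pullback-resp-≈ (pullback-paste pb-m pb-g) (≈-sym n'f'≈g'm')
                      (≈-sym (proj₁ pushout))
        pb-f = pullback-cancel pb-n rectangle βf'≈fα
        top = proj₂ (vanKampen f m n g m-mono pushout f' m' n' g' α β γ δ
                       n'f'≈g'm' pb-f pb-m (proj₁ pb-n) (proj₁ pb-g))
                    (pb-n , pb-g)
    in B' , f' , n' , β , top , pb-f , pb-n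

  -- Given a pushout  n ∘ f ≈ g ∘ m  with m
  -- mono and pullback squares over f and m, the span  B' ←f' A' →m'  has a
  -- pushout (m' is mono, being a pullback of m), which maps to the given one
  -- with pullback front faces.
  lift-pushout : ∀ {A B C D A' B' C'} {f : A ⇒ B} {m : A ⇒ C} {n : B ⇒ D} {g : C ⇒ D}
    {f' : A' ⇒ B'} {m' : A' ⇒ C'} {α : A' ⇒ A} {β : B' ⇒ B} {γ : C' ⇒ C} →
    Mono 𝒞 m → IsPushout 𝒞 f m n g →
    IsPullback 𝒞 f' α β f → IsPullback 𝒞 m' α γ m →
    Σ Obj λ D' → Σ (B' ⇒ D') λ n' → Σ (C' ⇒ D') λ g' → Σ (D' ⇒ D) λ δ →
      IsPushout 𝒞 f' m' n' g' × IsPullback 𝒞 n' β δ n × IsPullback 𝒞 g' γ δ g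
  lift-pushout {f = f} {m} {n} {g} {f'} {m'} {α} {β} {γ} m-mono pushout pb-f pb-m =
    let (D' , n' , g' , top) = pushouts f' m' (pullback-of-mono pb-m m-mono)
        (δ , δn'≈nβ , δg'≈gγ , _) = proj₂ top (n ∘ β) (g ∘ γ) cocone
        (pb-n , pb-g) = proj₁ (vanKampen f m n g m-mono pushout f' m' n' g' α β γ δ
                                 (proj₁ top) pb-f pb-m δn'≈nβ δg'≈gγ) top
    in D' , n' , g' , δ , top , pb-n , pb-g
    where
      cocone : (n ∘ β) ∘ f' ≈ (g ∘ γ) ∘ m'
      cocone = begin
        (n ∘ β) ∘ f'   ≈⟨ assoc ⟩
        n ∘ (β ∘ f')   ≈⟨ ≈-refl ⟩∘⟨ proj₁ pb-f ⟩
        n ∘ (f ∘ α)    ≈⟨ assoc⁻¹ ⟩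
        (n ∘ f) ∘ α    ≈⟨ proj₁ pushout ⟩∘⟨ ≈-refl ⟩
        (g ∘ m) ∘ α    ≈⟨ assoc ⟩
        g ∘ (m ∘ α)    ≈⟨ ≈-refl ⟩∘⟨ ≈-sym (proj₁ pb-m) ⟩
        g ∘ (γ ∘ m')   ≈⟨ assoc⁻¹ ⟩
        (g ∘ γ) ∘ m'   ∎
        where open SetoidReasoning hom-setoid

  lift-pushout-either : ∀ {A B C D A' B' C'} {f : A ⇒ B} {m : A ⇒ C} {n : B ⇒ D} {g : C ⇒ D}
    {f' : A' ⇒ B'} {m' : A' ⇒ C'} {α : A' ⇒ A} {β : B' ⇒ B} {γ : C' ⇒ C} →
    Mono 𝒞 f ⊎ Mono 𝒞 m → IsPushout 𝒞 f m n g →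
    IsPullback 𝒞 f' α β f → IsPullback 𝒞 m' α γ m →
    Σ Obj λ D' → Σ (B' ⇒ D') λ n' → Σ (C' ⇒ D') λ g' → Σ (D' ⇒ D) λ δ →
      IsPushout 𝒞 f' m' n' g' × IsPullback 𝒞 n' β δ n × IsPullback 𝒞 g' γ δ g
  lift-pushout-either (inj₂ m-mono) pushout pb-f pb-m = lift-pushout m-mono pushout pb-f pb-m
  lift-pushout-either (inj₁ f-mono) pushout pb-f pb-m =
    let (D' , g' , n' , δ , top , pb-g , pb-n) =
          lift-pushout f-mono (pushout-swap pushout) pb-m pb-f
    in D' , n' , g' , δ , pushout-swap top , pb-n , pb-g

mainTheorem3 : ∀ {o ℓ e : Level} (𝒞 : Category o ℓ e) → Adhesive 𝒞 →
    let open Category 𝒞 in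
    ∀ {L K R X Y Z : Obj}
    (a : K ⇒ L) (b : K ⇒ R) (c : Y ⇒ X) (d : Y ⇒ Z)
    (m : L ⇒ X) (j : K ⇒ Y) (n : R ⇒ Z) →
    IsPushout 𝒞 a j m c →
    IsPushout 𝒞 j b d n →
    ((Mono 𝒞 a × Mono 𝒞 m) ⊎ (Mono 𝒞 a × Mono 𝒞 b)) →
    ∀ {L' K' R' X' : Obj}
    (a' : K' ⇒ L') (b' : K' ⇒ R') (m' : L' ⇒ X')
    (ψL : L' ⇒ L) (ψK : K' ⇒ K) (ψR : R' ⇒ R) (ψX : X' ⇒ X) →
    IsPullback 𝒞 a' ψK ψL a →
    IsPullback 𝒞 b' ψK ψR b →
    IsPullback 𝒞 m' ψL ψX m →
    Σ Obj λ Y' → Σ Obj λ Z' →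
    Σ (Y' ⇒ X') λ c' → Σ (Y' ⇒ Z') λ d' → Σ (K' ⇒ Y') λ j' → Σ (R' ⇒ Z') λ n' →
    Σ (Y' ⇒ Y) λ ψY → Σ (Z' ⇒ Z) λ ψZ →
    IsPushout 𝒞 a' j' m' c' ×
    IsPushout 𝒞 j' b' d' n' ×
    IsPullback 𝒞 j' ψK ψY j ×
    IsPullback 𝒞 c' ψY ψX c ×
    IsPullback 𝒞 d' ψY ψZ d ×
    IsPullback 𝒞 n' ψR ψZ n
mainTheorem3 𝒞 adhesive a b c d m j n pushout₁ pushout₂ monos
             a' b' m' ψL ψK ψR ψX pb-a pb-b pb-m =
  let (Y' , j' , c' , ψY , pushout₁' , pb-j , pb-c) =
        restrict-pushout (a-mono monos) (pushout-swap pushout₁) pb-a pb-m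
      (Z' , d' , n' , ψZ , pushout₂' , pb-d , pb-n) =
        lift-pushout-either (j-or-b-mono monos) pushout₂ pb-j pb-b
  in Y' , Z' , c' , d' , j' , n' , ψY , ψZ ,
     pushout-swap pushout₁' , pushout₂' , pb-j , pb-c , pb-d , pb-n
  where
    open SquareFacts 𝒞
    open AdhesiveFacts 𝒞 adhesive

    a-mono : (Mono 𝒞 a × Mono 𝒞 m) ⊎ (Mono 𝒞 a × Mono 𝒞 b) → Mono 𝒞 a
    a-mono (inj₁ (a-mono , _)) = a-mono
    a-mono (inj₂ (a-mono , _)) = a-mono

    -- if a and m are mono, j is the pullback of m along c, hence mono
    j-or-b-mono : (Mono 𝒞 a × Mono 𝒞 m) ⊎ (Mono 𝒞 a × Mono 𝒞 b) → Mono 𝒞 j ⊎ Mono 𝒞 b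
    j-or-b-mono (inj₁ (a-mono , m-mono)) =
      inj₁ (pullback-of-mono
              (pushout-along-mono-is-pullback a-mono (pushout-swap pushout₁)) m-mono)
    j-or-b-mono (inj₂ (_ , b-mono)) = inj₂ b-mono
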